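{- For every integer $n\ge 0$, \[ \binom{2n}{n}\sum_{k=0}^{n}\binom{n}{k}^4=\binom{2n}{n}\sum_{k=0}^{n}\binom{n}{k}\binom{2k}{k}\binom{2n-2k}{n}\binom{n+k}{n-k}. \]
   Context: $\binom{m}{j}$ is the usual binomial coefficient for integers $m\ge0$, with $\binom{m}{j}=0$ if $j<0$ or $j>m$. -}

module Defs where

open import Data.Nat using (ℕ; zero; suc; _+_)

sumTo : ℕ → (ℕ → ℕ) → ℕ
sumTo zero f = f zero
sumTo (suc n) f = sumTo n f + f (suc n)

module Submission where

-- Creative telescoping. For either summand F(n,k) there is a G(n,k) with
--   c₀(n) F(n,k) + c₁(n) F(n+1,k) + c₂(n) F(n+2,k) = G(n,k+1) − G(n,k),
-- c₀(n) = −4(n+1)(4n+3)(4n+5), c₁(n) = −2(2n+3)(3n²+9n+7), c₂(n) = (n+2)³,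
-- and G(n,0) = G(n,n+3) = 0. Summing over k, both sums satisfy the same second order
-- recurrence; since c₂ never vanishes and the sums agree at n = 0 and n = 1, they agree
-- everywhere. For ∑ C(n,k)⁴ one takes
-- G = k⁴ q(n,k) C(n+2,k)⁴ / ((n+1)(n+2))⁴, for the other sum G = p(n,k) F(n+1,k−1) / (2n+3−2k),
-- with polynomials q and p of total degree 7 and 4. Through the ratios of neighbouring binomial
-- coefficients, each telescoping equation reduces to a polynomial identity.

module BinomialIdentities where

  open import Data.Nat using (ℕ; zero; suc; _+_; _*_)
  open import Data.Nat.Combinatorics using (_C_; nCk+nC[k+1]≡[n+1]C[k+1]; nC1≡n)
  open import Data.Nat.Properties using (*-zeroʳ; *-identityˡ; *-identityʳ; +-identityʳ)
  open import Data.Nat.Tactic.RingSolver using (solve-∀)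
  open import Relation.Binary.PropositionalEquality

  pascal : ∀ n k → suc n C suc k ≡ n C k + n C suc k
  pascal n k = sym (nCk+nC[k+1]≡[n+1]C[k+1] n k)

  [1+k]*[1+n]C[1+k]≡[1+n]*nCk : ∀ n k → suc k * (suc n C suc k) ≡ suc n * (n C k)
  [1+k]*[1+n]C[1+k]≡[1+n]*nCk zero    zero    = refl
  [1+k]*[1+n]C[1+k]≡[1+n]*nCk zero    (suc k) = *-zeroʳ (suc (suc k))
  [1+k]*[1+n]C[1+k]≡[1+n]*nCk (suc n) zero    =
    trans (*-identityˡ (suc (suc n) C 1)) (trans (nC1≡n (suc (suc n))) (sym (*-identityʳ (suc (suc n)))))
  [1+k]*[1+n]C[1+k]≡[1+n]*nCk (suc n) (suc k) = begin
    suc (suc k) * (suc (suc n) C suc (suc k))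
      ≡⟨ cong (suc (suc k) *_) (pascal (suc n) (suc k)) ⟩
    suc (suc k) * (x + y)
      ≡⟨ split x y k ⟩
    x + suc k * (suc n C suc k) + suc (suc k) * (suc n C suc (suc k))
      ≡⟨ cong₂ (λ u v → x + u + v) ([1+k]*[1+n]C[1+k]≡[1+n]*nCk n k) ([1+k]*[1+n]C[1+k]≡[1+n]*nCk n (suc k)) ⟩
    x + suc n * (n C k) + suc n * (n C suc k)
      ≡⟨ merge x (n C k) (n C suc k) n ⟩
    x + suc n * (n C k + n C suc k)
      ≡⟨ cong (λ u → x + suc n * u) (sym (pascal n k)) ⟩
    suc (suc n) * x ∎
    where
    open ≡-Reasoning
    x = suc n C suc k
    y = suc n C suc (suc k)
    split : ∀ x y k → suc (suc k) * (x + y) ≡ x + suc k * x + suc (suc k) * y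
    split = solve-∀
    merge : ∀ x u v n → x + suc n * u + suc n * v ≡ x + suc n * (u + v)
    merge = solve-∀

  [1+n]*[1+n]Ck≡[1+n]*nCk+k*[1+n]Ck : ∀ n k → suc n * (suc n C k) ≡ suc n * (n C k) + k * (suc n C k)
  [1+n]*[1+n]Ck≡[1+n]*nCk+k*[1+n]Ck n zero    = sym (+-identityʳ (suc n * 1))
  [1+n]*[1+n]Ck≡[1+n]*nCk+k*[1+n]Ck n (suc k) = begin
    suc n * (suc n C suc k)                       ≡⟨ cong (suc n *_) (pascal n k) ⟩
    suc n * (n C k + n C suc k)                   ≡⟨ swap (suc n) (n C k) (n C suc k) ⟩
    suc n * (n C suc k) + suc n * (n C k)         ≡⟨ cong (suc n * (n C suc k) +_) (sym ([1+k]*[1+n]C[1+k]≡[1+n]*nCk n k)) ⟩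
    suc n * (n C suc k) + suc k * (suc n C suc k) ∎
    where
    open ≡-Reasoning
    swap : ∀ m x y → m * (x + y) ≡ m * y + m * x
    swap = solve-∀

  [1+k]*nC[1+k]+k*nCk≡n*nCk : ∀ n k → suc k * (n C suc k) + k * (n C k) ≡ n * (n C k)
  [1+k]*nC[1+k]+k*nCk≡n*nCk zero    zero    = refl
  [1+k]*nC[1+k]+k*nCk≡n*nCk zero    (suc k) = cong₂ _+_ (*-zeroʳ (suc (suc k))) (*-zeroʳ (suc k))
  [1+k]*nC[1+k]+k*nCk≡n*nCk (suc n) k       =
    trans (cong (_+ k * (suc n C k)) ([1+k]*[1+n]C[1+k]≡[1+n]*nCk n k))
          (sym ([1+n]*[1+n]Ck≡[1+n]*nCk+k*[1+n]Ck n k))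

module Telescoping where

  open import Defs using (sumTo)
  open import Data.Nat as ℕ using (ℕ; zero; suc; _<_)
  open import Data.Nat.Properties using (m<n⇒m<1+n; n<1+n; m≤n+m)
  open import Data.Integer using (ℤ; +_; 0ℤ; _+_; _*_; _-_; ≢-nonZero)
  open import Data.Integer.Properties as ℤ using (+-identityʳ; *-zeroʳ; pos-+; *-cancelˡ-≡)
  open import Algebra.Properties.AbelianGroup ℤ.+-0-abelianGroup using (∙-cancelˡ)
  open import Data.Integer.Tactic.RingSolver using (solve-∀)
  open import Data.Product using (_×_; _,_; proj₁)
  open import Function using (_∘_)
  open import Relation.Binary.PropositionalEquality

  *-cancelˡ : ∀ {a x y} → a ≢ 0ℤ → a * x ≡ a * y → x ≡ y
  *-cancelˡ {a} {x} {y} a≢0 = *-cancelˡ-≡ a x y {{≢-nonZero a≢0}}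

  *≡0⇒≡0 : ∀ {a x} → a ≢ 0ℤ → a * x ≡ 0ℤ → x ≡ 0ℤ
  *≡0⇒≡0 {a} a≢0 ax≡0 = *-cancelˡ a≢0 (trans ax≡0 (sym (*-zeroʳ a)))

  sum< : ℕ → (ℕ → ℤ) → ℤ
  sum< zero    f = 0ℤ
  sum< (suc K) f = sum< K f + f K

  sumTo≡sum< : ∀ n f → + sumTo n f ≡ sum< (suc n) (+_ ∘ f)
  sumTo≡sum< zero    f = refl
  sumTo≡sum< (suc n) f = trans (pos-+ (sumTo n f) (f (suc n))) (cong (_+ + f (suc n)) (sumTo≡sum< n f))

  sum<-vanishing-tail : ∀ r K f → (∀ i → f (i ℕ.+ K) ≡ 0ℤ) → sum< (r ℕ.+ K) f ≡ sum< K f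
  sum<-vanishing-tail zero    K f tail = refl
  sum<-vanishing-tail (suc r) K f tail = begin
    sum< (r ℕ.+ K) f + f (r ℕ.+ K) ≡⟨ cong (λ x → sum< (r ℕ.+ K) f + x) (tail r) ⟩
    sum< (r ℕ.+ K) f + 0ℤ          ≡⟨ +-identityʳ _ ⟩
    sum< (r ℕ.+ K) f               ≡⟨ sum<-vanishing-tail r K f tail ⟩
    sum< K f                       ∎
    where open ≡-Reasoning

  sum<-+ : ∀ K f g → sum< K (λ k → f k + g k) ≡ sum< K f + sum< K g
  sum<-+ zero    f g = refl
  sum<-+ (suc K) f g = trans (cong (_+ (f K + g K)) (sum<-+ K f g)) (interchange (sum< K f) (sum< K g) (f K) (g K))
    where
    interchange : ∀ a b c d → a + b + (c + d) ≡ a + c + (b + d)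
    interchange = solve-∀

  sum<-*ˡ : ∀ K c f → sum< K (λ k → c * f k) ≡ c * sum< K f
  sum<-*ˡ zero    c f = sym (*-zeroʳ c)
  sum<-*ˡ (suc K) c f = trans (cong (_+ c * f K) (sum<-*ˡ K c f)) (distrib c (sum< K f) (f K))
    where
    distrib : ∀ c s x → c * s + c * x ≡ c * (s + x)
    distrib = solve-∀

  -- With G k = H k / d k, this says t k = G (k + 1) − G k.
  TelescopingStep : (d H t : ℕ → ℤ) → ℕ → Set
  TelescopingStep d H t k = d (suc k) * d k * t k ≡ d k * H (suc k) - d (suc k) * H k

  sum<-telescoping : ∀ (d H t : ℕ → ℤ) K → (∀ k → d k ≢ 0ℤ) → H 0 ≡ 0ℤ →
                     (∀ k → k < K → TelescopingStep d H t k) → d K * sum< K t ≡ H K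
  sum<-telescoping d H t zero    d≢0 H₀≡0 step = trans (*-zeroʳ (d 0)) (sym H₀≡0)
  sum<-telescoping d H t (suc K) d≢0 H₀≡0 step = *-cancelˡ (d≢0 K) (begin
    d K * (d (suc K) * (sum< K t + t K))                 ≡⟨ expand (d K) (d (suc K)) (sum< K t) (t K) ⟩
    d (suc K) * (d K * sum< K t) + d (suc K) * d K * t K  ≡⟨ cong₂ (λ u v → d (suc K) * u + v) previous (step K (n<1+n K)) ⟩
    d (suc K) * H K + (d K * H (suc K) - d (suc K) * H K) ≡⟨ cancel (d K) (d (suc K)) (H K) (H (suc K)) ⟩
    d K * H (suc K)                                       ∎)
    where
    open ≡-Reasoning
    previous : d K * sum< K t ≡ H K
    previous = sum<-telescoping d H t K d≢0 H₀≡0 (λ k k<K → step k (m<n⇒m<1+n k<K))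
    expand : ∀ a b s x → a * (b * (s + x)) ≡ b * (a * s) + b * a * x
    expand = solve-∀
    cancel : ∀ a b h h′ → b * h + (a * h′ - b * h) ≡ a * h′
    cancel = solve-∀

  sum<≡0-by-telescoping : ∀ (d H t : ℕ → ℤ) K → (∀ k → d k ≢ 0ℤ) → H 0 ≡ 0ℤ → H K ≡ 0ℤ →
                          (∀ k → k < K → TelescopingStep d H t k) → sum< K t ≡ 0ℤ
  sum<≡0-by-telescoping d H t K d≢0 H₀≡0 H≡0 step =
    *≡0⇒≡0 (d≢0 K) (trans (sum<-telescoping d H t K d≢0 H₀≡0 step) H≡0)

  module SecondOrder (c₀ c₁ c₂ : ℕ → ℤ) where

    L : (ℕ → ℕ → ℤ) → ℕ → ℕ → ℤ
    L F n k = c₀ n * F n k + c₁ n * F (suc n) k + c₂ n * F (suc (suc n)) k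

    Annihilates : (ℕ → ℤ) → Set
    Annihilates a = ∀ n → c₀ n * a n + c₁ n * a (suc n) + c₂ n * a (suc (suc n)) ≡ 0ℤ

    annihilates-column-sums : ∀ F → (∀ m k → m < k → F m k ≡ 0ℤ) →
                              (∀ n → sum< (3 ℕ.+ n) (L F n) ≡ 0ℤ) →
                              Annihilates (λ m → sum< (suc m) (F m))
    annihilates-column-sums F support telescopes n = begin
      c₀ n * S n + c₁ n * S (1 ℕ.+ n) + c₂ n * S (2 ℕ.+ n)
        ≡⟨ cong₂ (λ u v → c₀ n * u + c₁ n * v + c₂ n * S (2 ℕ.+ n)) (sym (padded 2 n)) (sym (padded 1 (suc n))) ⟩
      c₀ n * T n + c₁ n * T (1 ℕ.+ n) + c₂ n * T (2 ℕ.+ n)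
        ≡⟨ cong₂ _+_ (cong₂ _+_ (sym (sum<-*ˡ (3 ℕ.+ n) (c₀ n) (F n))) (sym (sum<-*ˡ (3 ℕ.+ n) (c₁ n) (F (1 ℕ.+ n)))))
                     (sym (sum<-*ˡ (3 ℕ.+ n) (c₂ n) (F (2 ℕ.+ n)))) ⟩
      sum< (3 ℕ.+ n) (λ k → c₀ n * F n k) + sum< (3 ℕ.+ n) (λ k → c₁ n * F (1 ℕ.+ n) k)
        + sum< (3 ℕ.+ n) (λ k → c₂ n * F (2 ℕ.+ n) k)
        ≡⟨ cong (_+ sum< (3 ℕ.+ n) (λ k → c₂ n * F (2 ℕ.+ n) k)) (sym (sum<-+ (3 ℕ.+ n) _ _)) ⟩
      sum< (3 ℕ.+ n) (λ k → c₀ n * F n k + c₁ n * F (1 ℕ.+ n) k) + sum< (3 ℕ.+ n) (λ k → c₂ n * F (2 ℕ.+ n) k)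
        ≡⟨ sym (sum<-+ (3 ℕ.+ n) _ _) ⟩
      sum< (3 ℕ.+ n) (L F n)
        ≡⟨ telescopes n ⟩
      0ℤ ∎
      where
      open ≡-Reasoning
      S T : ℕ → ℤ
      S m = sum< (suc m) (F m)
      T m = sum< (3 ℕ.+ n) (F m)
      padded : ∀ r m → sum< (r ℕ.+ suc m) (F m) ≡ S m
      padded r m = sum<-vanishing-tail r (suc m) (F m) (λ i → support m (i ℕ.+ suc m) (m≤n+m (suc m) i))

    annihilated-sequences-agree : (∀ n → c₂ n ≢ 0ℤ) → ∀ {a b} → Annihilates a → Annihilates b →
                                  a 0 ≡ b 0 → a 1 ≡ b 1 → ∀ n → a n ≡ b n
    annihilated-sequences-agree c₂≢0 {a} {b} La Lb a₀≡b₀ a₁≡b₁ n = proj₁ (consecutive n)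
      where
      consecutive : ∀ n → a n ≡ b n × a (suc n) ≡ b (suc n)
      consecutive zero    = a₀≡b₀ , a₁≡b₁
      consecutive (suc n) with consecutive n
      ... | aₙ≡bₙ , aₙ₊₁≡bₙ₊₁ = aₙ₊₁≡bₙ₊₁ , *-cancelˡ (c₂≢0 n) (∙-cancelˡ (c₀ n * a n + c₁ n * a (suc n)) _ _ (begin
        c₀ n * a n + c₁ n * a (suc n) + c₂ n * a (2 ℕ.+ n) ≡⟨ La n ⟩
        0ℤ                                                 ≡⟨ sym (Lb n) ⟩
        c₀ n * b n + c₁ n * b (suc n) + c₂ n * b (2 ℕ.+ n) ≡⟨ cong₂ (λ u v → c₀ n * u + c₁ n * v + c₂ n * b (2 ℕ.+ n))
                                                                    (sym aₙ≡bₙ) (sym aₙ₊₁≡bₙ₊₁) ⟩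
        c₀ n * a n + c₁ n * a (suc n) + c₂ n * b (2 ℕ.+ n) ∎))
        where open ≡-Reasoning

module BinomialRatios where

  open import Data.Nat as ℕ using (ℕ; suc)
  open import Data.Nat.Combinatorics using (_C_)
  open import Data.Integer using (ℤ; +_; 0ℤ; _+_; _*_; _-_)
  open import Data.Integer.Properties as ℤ using (pos-+; pos-*; i≡j⇒i-j≡0; i-j≡0⇒i≡j)
  open import Data.Integer.Tactic.RingSolver using (solve-∀)
  open import Function using (_$_)
  open import Relation.Binary.PropositionalEquality
  open BinomialIdentities
  open Telescoping using (*-cancelˡ; *≡0⇒≡0)

  -- A record, so that unification recovers x, P, y and Q even where ℤ multiplication computes.
  record Proportional (x P y Q : ℤ) : Set where
    constructor proportional
    field cross : x * P ≡ y * Q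

  open Proportional public

  proportional-sym : ∀ {x P y Q} → Proportional x P y Q → Proportional y Q x P
  proportional-sym (proportional e) = proportional (sym e)

  proportional-subst : ∀ {x P P′ y Q Q′} → P ≡ P′ → Q ≡ Q′ → Proportional x P y Q → Proportional x P′ y Q′
  proportional-subst refl refl r = r

  proportional-coefficients : ∀ {x x′ P y y′ Q} → x ≡ x′ → y ≡ y′ → Proportional x P y Q → Proportional x′ P y′ Q
  proportional-coefficients refl refl r = r

  proportional-chain : ∀ {x₁ y₁ x₂ y₂ P Q R} → Proportional x₁ P y₁ Q → Proportional x₂ Q y₂ R →
                       Proportional (x₁ * x₂) P (y₁ * y₂) R
  proportional-chain {x₁} {y₁} {x₂} {y₂} {P} {Q} {R} (proportional r₁) (proportional r₂) = proportional (begin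
    x₁ * x₂ * P   ≡⟨ rearrange x₁ x₂ P ⟩
    x₂ * (x₁ * P) ≡⟨ cong (x₂ *_) r₁ ⟩
    x₂ * (y₁ * Q) ≡⟨ rearrange′ x₂ y₁ Q ⟩
    y₁ * (x₂ * Q) ≡⟨ cong (y₁ *_) r₂ ⟩
    y₁ * (y₂ * R) ≡⟨ sym (ℤ.*-assoc y₁ y₂ R) ⟩
    y₁ * y₂ * R   ∎)
    where
    open ≡-Reasoning
    rearrange : ∀ a b p → a * b * p ≡ b * (a * p)
    rearrange = solve-∀
    rearrange′ : ∀ a b p → a * (b * p) ≡ b * (a * p)
    rearrange′ = solve-∀

  proportional-product : ∀ {x₁ y₁ x₂ y₂ x₃ y₃ x₄ y₄ P₁ Q₁ P₂ Q₂ P₃ Q₃ P₄ Q₄} →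
    Proportional x₁ P₁ y₁ Q₁ → Proportional x₂ P₂ y₂ Q₂ → Proportional x₃ P₃ y₃ Q₃ → Proportional x₄ P₄ y₄ Q₄ →
    Proportional (x₁ * x₂ * x₃ * x₄) (P₁ * P₂ * P₃ * P₄) (y₁ * y₂ * y₃ * y₄) (Q₁ * Q₂ * Q₃ * Q₄)
  proportional-product {x₁} {y₁} {x₂} {y₂} {x₃} {y₃} {x₄} {y₄} {P₁} {Q₁} {P₂} {Q₂} {P₃} {Q₃} {P₄} {Q₄}
                       (proportional r₁) (proportional r₂) (proportional r₃) (proportional r₄) = proportional (begin
    x₁ * x₂ * x₃ * x₄ * (P₁ * P₂ * P₃ * P₄)        ≡⟨ pair-up x₁ x₂ x₃ x₄ P₁ P₂ P₃ P₄ ⟩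
    (x₁ * P₁) * (x₂ * P₂) * (x₃ * P₃) * (x₄ * P₄)  ≡⟨ cong₂ (λ u v → u * v * (x₃ * P₃) * (x₄ * P₄)) r₁ r₂ ⟩
    (y₁ * Q₁) * (y₂ * Q₂) * (x₃ * P₃) * (x₄ * P₄)  ≡⟨ cong₂ (λ u v → (y₁ * Q₁) * (y₂ * Q₂) * u * v) r₃ r₄ ⟩
    (y₁ * Q₁) * (y₂ * Q₂) * (y₃ * Q₃) * (y₄ * Q₄)  ≡⟨ sym (pair-up y₁ y₂ y₃ y₄ Q₁ Q₂ Q₃ Q₄) ⟩
    y₁ * y₂ * y₃ * y₄ * (Q₁ * Q₂ * Q₃ * Q₄)        ∎)
    where
    open ≡-Reasoning
    pair-up : ∀ a b c d p q r s → a * b * c * d * (p * q * r * s) ≡ (a * p) * (b * q) * (c * r) * (d * s)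
    pair-up = solve-∀

  proportional-rescale : ∀ m {α β x y X Y} → m ≢ 0ℤ → m * α ≡ x → m * β ≡ y →
                         Proportional x X y Y → Proportional α X β Y
  proportional-rescale m {α} {β} {x} {y} {X} {Y} m≢0 mα≡x mβ≡y (proportional r) = proportional (*-cancelˡ m≢0 (begin
    m * (α * X) ≡⟨ sym (ℤ.*-assoc m α X) ⟩
    m * α * X   ≡⟨ cong (_* X) mα≡x ⟩
    x * X       ≡⟨ r ⟩
    y * Y       ≡⟨ cong (_* Y) (sym mβ≡y) ⟩
    m * β * Y   ≡⟨ ℤ.*-assoc m β Y ⟩
    m * (β * Y) ∎))
    where open ≡-Reasoning

  cross-difference : ∀ {x P y Q} → Proportional x P y Q → x * P - y * Q ≡ 0ℤ
  cross-difference r = i≡j⇒i-j≡0 (cross r)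

  ≡-by-certificate : ∀ K {a b c} → K ≢ 0ℤ → K * (a - b) ≡ c → c ≡ 0ℤ → a ≡ b
  ≡-by-certificate K {a} {b} K≢0 certificate c≡0 = i-j≡0⇒i≡j a b (*≡0⇒≡0 K≢0 (trans certificate c≡0))

  combination₂≡0 : ∀ a b {u v} → u ≡ 0ℤ → v ≡ 0ℤ → a * u + b * v ≡ 0ℤ
  combination₂≡0 a b refl refl = zeros a b
    where
    zeros : ∀ a b → a * 0ℤ + b * 0ℤ ≡ 0ℤ
    zeros = solve-∀

  combination₃≡0 : ∀ a b c {u v w} → u ≡ 0ℤ → v ≡ 0ℤ → w ≡ 0ℤ → a * u + b * v + c * w ≡ 0ℤ
  combination₃≡0 a b c refl refl refl = zeros a b c
    where
    zeros : ∀ a b c → a * 0ℤ + b * 0ℤ + c * 0ℤ ≡ 0ℤ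
    zeros = solve-∀

  _Cᶻ_ : ℕ → ℕ → ℤ
  n Cᶻ k = + (n C k)

  private
    pos-*-+-* : ∀ a b c d e f → a ℕ.* b ≡ c ℕ.* d ℕ.+ e ℕ.* f → + a * + b ≡ + c * + d + + e * + f
    pos-*-+-* a b c d e f eq = begin
      + a * + b                  ≡⟨ sym (pos-* a b) ⟩
      + (a ℕ.* b)                ≡⟨ cong +_ eq ⟩
      + (c ℕ.* d ℕ.+ e ℕ.* f)    ≡⟨ pos-+ (c ℕ.* d) (e ℕ.* f) ⟩
      + (c ℕ.* d) + + (e ℕ.* f)  ≡⟨ cong₂ _+_ (pos-* c d) (pos-* e f) ⟩
      + c * + d + + e * + f      ∎
      where open ≡-Reasoning

  Cᶻ-absorb : ∀ n k → Proportional (+ suc k) (suc n Cᶻ suc k) (+ suc n) (n Cᶻ k)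
  Cᶻ-absorb n k = proportional $
    trans (sym (pos-* (suc k) (suc n C suc k))) (trans (cong +_ ([1+k]*[1+n]C[1+k]≡[1+n]*nCk n k)) (pos-* (suc n) (n C k)))

  Cᶻ-top-step : ∀ n k → Proportional (+ suc n - + k) (suc n Cᶻ k) (+ suc n) (n Cᶻ k)
  Cᶻ-top-step n k = proportional $ move (+ suc n) (+ k) (suc n Cᶻ k) (n Cᶻ k)
    (pos-*-+-* (suc n) (suc n C k) (suc n) (n C k) k (suc n C k) ([1+n]*[1+n]Ck≡[1+n]*nCk+k*[1+n]Ck n k))
    where
    move : ∀ m k x y → m * x ≡ m * y + k * x → (m - k) * x ≡ m * y
    move m k x y eq = trans (expand m k x) (trans (cong (_- k * x) eq) (cancel m k x y))
      where
      expand : ∀ m k x → (m - k) * x ≡ m * x - k * x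
      expand = solve-∀
      cancel : ∀ m k x y → m * y + k * x - k * x ≡ m * y
      cancel = solve-∀

  Cᶻ-bottom-step : ∀ n k → Proportional (+ suc k) (n Cᶻ suc k) (+ n - + k) (n Cᶻ k)
  Cᶻ-bottom-step n k = proportional $ move (+ suc k) (+ k) (+ n) (n Cᶻ suc k) (n Cᶻ k)
    (sym (pos-*-+-* n (n C k) (suc k) (n C suc k) k (n C k) (sym ([1+k]*nC[1+k]+k*nCk≡n*nCk n k))))
    where
    move : ∀ s k m x y → s * x + k * y ≡ m * y → s * x ≡ (m - k) * y
    move s k m x y eq = trans (expand s k x y) (trans (cong (_- k * y) eq) (factor m k y))
      where
      expand : ∀ s k x y → s * x ≡ s * x + k * y - k * y
      expand = solve-∀
      factor : ∀ m k y → m * y - k * y ≡ (m - k) * y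
      factor = solve-∀

module Certificates where

  open import Agda.Builtin.FromNat
  open import Agda.Builtin.FromNeg
  open import Data.Nat using (ℕ)
  import Data.Nat.Literals as ℕ
  open import Data.Integer using (ℤ; _+_; _*_; _-_)
  import Data.Integer.Literals as ℤ
  open import Data.Integer.Tactic.RingSolver using (solve-∀)
  open import Data.Unit using (tt) public
  open import Relation.Binary.PropositionalEquality using (_≡_)

  instance
    ℕ-number : Number ℕ
    ℕ-number = ℕ.number
    ℤ-number : Number ℤ
    ℤ-number = ℤ.number
    ℤ-negative : Negative ℤ
    ℤ-negative = ℤ.negative

  -- The polynomials below are INLINE so that the ring solver sees through them. Constants
  -- stand to the left (1 + N, not N + 1): at N = + n this reduces to + suc n, the form in
  -- which the binomial lemmas state their coefficients.

  _³ _⁴ : ℤ → ℤ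
  x ³ = x * x * x
  x ⁴ = x * x * x * x
  {-# INLINE _³ #-}
  {-# INLINE _⁴ #-}

  c₀ c₁ c₂ : ℤ → ℤ
  c₀ N = -4 * (1 + N) * (4 * N + 3) * (4 * N + 5)
  c₁ N = -2 * (2 * N + 3) * (3 * N * N + 9 * N + 7)
  c₂ N = (2 + N) ³
  {-# INLINE c₀ #-}
  {-# INLINE c₁ #-}
  {-# INLINE c₂ #-}

  certificateˡ : ℤ → ℤ → ℤ
  certificateˡ N K =
    (((((((-75 * N + (260 * K - 800)) * N + ((-374 * K + 2316) * K - 3610)) * N
    + (((276 * K - 2688) * K + 8476) * K - 8930)) * N
    + ((((-104 * K + 1520) * K - 7612) * K + 16312) * K - 13075)) * N
    + (((((16 * K - 402) * K + 3088) * K - 10620) * K + 17412) * K - 11330)) * N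
    + (((((36 * K - 508) * K + 2744) * K - 7302) * K + 9776) * K - 5380)) * N
    + (((((20 * K - 210) * K + 900) * K - 1980) * K + 2256) * K - 1080))
  {-# INLINE certificateˡ #-}

  certificateˡ-identity : ∀ N K →
    c₀ N * ((1 + N - K) * (2 + N - K)) ⁴ + c₁ N * ((1 + N) * (2 + N - K)) ⁴ + c₂ N * ((1 + N) * (2 + N)) ⁴
      ≡ (2 + N - K) ⁴ * certificateˡ N (1 + K) - K ⁴ * certificateˡ N K
  certificateˡ-identity = solve-∀

  dʳ : ℤ → ℤ → ℤ
  dʳ N K = 2 * N + 3 - 2 * K
  {-# INLINE dʳ #-}

  certificateʳ : ℤ → ℤ → ℤ
  certificateʳ N K =
    (((-48 * N + (168 * K - 368)) * N + ((-168 * K + 876) * K - 1014)) * N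
    + (((48 * K - 528) * K + 1476) * K - 1198)) * N
    + (((64 * K - 408) * K + 812) * K - 516)
  {-# INLINE certificateʳ #-}

  -- αˣ J E * X ≡ βˣ J E * Y relates the summand X = F(J+E+i, J+1), for i = 0, 1, 2 (x = A, B, C),
  -- to Y = F(J+E+1, J).
  αᴬ βᴬ αᴮ βᴮ αᶜ βᶜ : ℤ → ℤ → ℤ
  αᴬ J E = 4 * (1 + J) ³ * (2 * E + 1) * (2 * E - 1)
  βᴬ J E = (1 + E) * E * (1 + E - J) * (E - J) * (E - J - 1)
  αᴮ J E = 2 * (1 + J) ³ * (2 * E + 1)
  βᴮ J E = (2 + 2 * J + E) * (1 + E) * (1 + E - J) * (E - J)
  αᶜ J E = (1 + J) ³
  βᶜ J E = (2 + 2 * J + E) * (3 + 2 * J + E) * (1 + E - J)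
  {-# INLINE αᴬ #-}
  {-# INLINE βᴬ #-}
  {-# INLINE αᴮ #-}
  {-# INLINE βᴮ #-}
  {-# INLINE αᶜ #-}
  {-# INLINE βᶜ #-}

  λᴬ λᴮ λᶜ : ℤ → ℤ → ℤ
  λᴬ J E = c₀ (J + E)
  λᴮ J E = 2 * ((2 * E - 1) * c₁ (J + E) - certificateʳ (J + E) (2 + J))
  λᶜ J E = 4 * (2 * E - 1) * (2 * E + 1) * c₂ (J + E)
  {-# INLINE λᴬ #-}
  {-# INLINE λᴮ #-}
  {-# INLINE λᶜ #-}

  certificateʳ-identity : ∀ J E X₀ X₁ X₂ Y → let N = J + E in
    4 * (1 + J) ³ * (dʳ N (2 + J) * dʳ N (1 + J) * (c₀ N * X₀ + c₁ N * X₁ + c₂ N * X₂)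
                     - (dʳ N (1 + J) * (certificateʳ N (2 + J) * X₁) - dʳ N (2 + J) * (certificateʳ N (1 + J) * Y)))
      ≡ λᴬ J E * (αᴬ J E * X₀ - βᴬ J E * Y) + λᴮ J E * (αᴮ J E * X₁ - βᴮ J E * Y) + λᶜ J E * (αᶜ J E * X₂ - βᶜ J E * Y)
  certificateʳ-identity = solve-∀

  μ₁ μ₂ : ℤ → ℤ
  μ₁ N = (2 + N) * (2 + N) * (dʳ N 1 * dʳ N 0 * c₁ N - dʳ N 0 * certificateʳ N 1) + (4 + 2 * N) * (3 + 2 * N) * dʳ N 1 * dʳ N 0 * c₂ N
  μ₂ N = (1 + N) * (1 + N) * dʳ N 1 * dʳ N 0 * c₂ N
  {-# INLINE μ₁ #-}
  {-# INLINE μ₂ #-}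

  certificateʳ-initial-identity : ∀ N Z₀ Z₁ Z₂ → let N′ = 1 + N in
    ((1 + N) * (2 + N)) * ((1 + N) * (2 + N))
      * (dʳ N 1 * dʳ N 0 * (c₀ N * Z₀ + c₁ N * Z₁ + c₂ N * Z₂) - (dʳ N 0 * (certificateʳ N 1 * Z₁) - dʳ N 1 * 0))
    ≡ μ₁ N * ((1 + N) * (1 + N) * Z₁ - (2 + (N + N)) * (1 + (N + N)) * Z₀)
      + μ₂ N * ((1 + N′) * (1 + N′) * Z₂ - (2 + (N′ + N′)) * (1 + (N′ + N′)) * Z₁)
  certificateʳ-initial-identity = solve-∀

module FourthPowerSum where

  open import Agda.Builtin.FromNat
  open import Data.Nat as ℕ using (ℕ; zero; suc)
  open import Data.Nat.Properties using (n<1+n)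
  open import Data.Nat.Combinatorics using (_C_; k>n⇒nCk≡0)
  open import Data.Integer using (ℤ; +_; 0ℤ; _+_; _*_; _-_; _^_)
  open import Data.Integer.Properties using (*-zeroʳ; pos-*)
  open import Data.Integer.Tactic.RingSolver using (solve-∀)
  open import Relation.Binary.PropositionalEquality using (_≡_; refl; sym; trans; cong; cong₂; module ≡-Reasoning)
  open Certificates
  open Telescoping
  open BinomialRatios
  open SecondOrder (λ n → c₀ (+ n)) (λ n → c₁ (+ n)) (λ n → c₂ (+ n))

  pos-^ : ∀ x e → + (x ℕ.^ e) ≡ (+ x) ^ e
  pos-^ x zero    = refl
  pos-^ x (suc e) = trans (pos-* x (x ℕ.^ e)) (cong (+ x *_) (pos-^ x e))

  pos-⁴ : ∀ x → + (x ℕ.^ 4) ≡ (+ x) ⁴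
  pos-⁴ x = trans (pos-^ x 4) (reassociate (+ x))
    where
    reassociate : ∀ y → y * (y * (y * (y * 1))) ≡ y ⁴
    reassociate = solve-∀

  Fˡ : ℕ → ℕ → ℤ
  Fˡ m k = + ((m C k) ℕ.^ 4)

  Mˡ : ℕ → ℤ
  Mˡ n = ((1 + + n) * (2 + + n)) ⁴

  Gˡ : ℕ → ℕ → ℤ
  Gˡ n k = (+ k) ⁴ * certificateˡ (+ n) (+ k) * ((2 ℕ.+ n) Cᶻ k) ⁴

  Mˡ*LFˡ≡ΔGˡ : ∀ n k → Mˡ n * L Fˡ n k ≡ Gˡ n (suc k) - Gˡ n k
  Mˡ*LFˡ≡ΔGˡ n k = begin
    Mˡ n * L Fˡ n k
      ≡⟨ cong (Mˡ n *_) (cong₂ _+_ (cong₂ (λ u v → c₀ N * u + c₁ N * v) (pos-⁴ (n C k)) (pos-⁴ (suc n C k)))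
                                   (cong (c₂ N *_) (pos-⁴ (suc (suc n) C k)))) ⟩
    Mˡ n * (c₀ N * x₀ ⁴ + c₁ N * x₁ ⁴ + c₂ N * x₂ ⁴)
      ≡⟨ distribute (c₀ N) (c₁ N) (c₂ N) (Mˡ n) (x₀ ⁴) (x₁ ⁴) (x₂ ⁴) ⟩
    c₀ N * (Mˡ n * x₀ ⁴) + c₁ N * (Mˡ n * x₁ ⁴) + c₂ N * ((1 + N) * (2 + N)) ⁴ * x₂ ⁴
      ≡⟨ cong₂ (λ u v → c₀ N * u + c₁ N * v + c₂ N * ((1 + N) * (2 + N)) ⁴ * x₂ ⁴) Mˡx₀⁴ Mˡx₁⁴ ⟩
    c₀ N * ((1 + N - K) * ((2 + N - K) * x₂)) ⁴ + c₁ N * ((1 + N) * ((2 + N - K) * x₂)) ⁴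
      + c₂ N * ((1 + N) * (2 + N)) ⁴ * x₂ ⁴
      ≡⟨ factor (c₀ N) (c₁ N) (c₂ N) (1 + N - K) (1 + N) (2 + N - K) (2 + N) x₂ ⟩
    (c₀ N * ((1 + N - K) * (2 + N - K)) ⁴ + c₁ N * ((1 + N) * (2 + N - K)) ⁴ + c₂ N * ((1 + N) * (2 + N)) ⁴) * x₂ ⁴
      ≡⟨ cong (_* x₂ ⁴) (certificateˡ-identity N K) ⟩
    ((2 + N - K) ⁴ * certificateˡ N (1 + K) - K ⁴ * certificateˡ N K) * x₂ ⁴
      ≡⟨ regroup (2 + N - K) (certificateˡ N (1 + K)) (K ⁴ * certificateˡ N K) x₂ ⟩
    certificateˡ N (1 + K) * ((2 + N - K) * x₂) ⁴ - Gˡ n k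
      ≡⟨ cong (λ u → certificateˡ N (1 + K) * u ⁴ - Gˡ n k) (sym (cross (Cᶻ-bottom-step (2 ℕ.+ n) k))) ⟩
    certificateˡ N (1 + K) * ((1 + K) * y) ⁴ - Gˡ n k
      ≡⟨ cong (_- Gˡ n k) (commute (1 + K) (certificateˡ N (1 + K)) y) ⟩
    Gˡ n (suc k) - Gˡ n k ∎
    where
    open ≡-Reasoning
    N K x₀ x₁ x₂ y : ℤ
    N = + n
    K = + k
    x₀ = n Cᶻ k
    x₁ = suc n Cᶻ k
    x₂ = suc (suc n) Cᶻ k
    y = suc (suc n) Cᶻ suc k
    mul⁴ : ∀ a b x → (a * b) ⁴ * x ⁴ ≡ (a * (b * x)) ⁴
    mul⁴ = solve-∀
    swap⁴ : ∀ a b x → (a * (b * x)) ⁴ ≡ (b * (a * x)) ⁴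
    swap⁴ = solve-∀
    Mˡx₀⁴ : Mˡ n * x₀ ⁴ ≡ ((1 + N - K) * ((2 + N - K) * x₂)) ⁴
    Mˡx₀⁴ = begin
      Mˡ n * x₀ ⁴                          ≡⟨ mul⁴ (1 + N) (2 + N) x₀ ⟩
      ((1 + N) * ((2 + N) * x₀)) ⁴         ≡⟨ swap⁴ (1 + N) (2 + N) x₀ ⟩
      ((2 + N) * ((1 + N) * x₀)) ⁴         ≡⟨ cong (λ u → ((2 + N) * u) ⁴) (sym (cross (Cᶻ-top-step n k))) ⟩
      ((2 + N) * ((1 + N - K) * x₁)) ⁴     ≡⟨ swap⁴ (2 + N) (1 + N - K) x₁ ⟩
      ((1 + N - K) * ((2 + N) * x₁)) ⁴     ≡⟨ cong (λ u → ((1 + N - K) * u) ⁴) (sym (cross (Cᶻ-top-step (suc n) k))) ⟩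
      ((1 + N - K) * ((2 + N - K) * x₂)) ⁴ ∎
    Mˡx₁⁴ : Mˡ n * x₁ ⁴ ≡ ((1 + N) * ((2 + N - K) * x₂)) ⁴
    Mˡx₁⁴ = begin
      Mˡ n * x₁ ⁴                      ≡⟨ mul⁴ (1 + N) (2 + N) x₁ ⟩
      ((1 + N) * ((2 + N) * x₁)) ⁴     ≡⟨ cong (λ u → ((1 + N) * u) ⁴) (sym (cross (Cᶻ-top-step (suc n) k))) ⟩
      ((1 + N) * ((2 + N - K) * x₂)) ⁴ ∎
    distribute : ∀ a b c m x y z → m * (a * x + b * y + c * z) ≡ a * (m * x) + b * (m * y) + c * m * z
    distribute = solve-∀
    factor : ∀ c₀ c₁ c₂ a b d e x → c₀ * (a * (d * x)) ⁴ + c₁ * (b * (d * x)) ⁴ + c₂ * (b * e) ⁴ * x ⁴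
                                    ≡ (c₀ * (a * d) ⁴ + c₁ * (b * d) ⁴ + c₂ * (b * e) ⁴) * x ⁴
    factor = solve-∀
    regroup : ∀ d q g x → (d ⁴ * q - g) * x ⁴ ≡ q * (d * x) ⁴ - g * x ⁴
    regroup = solve-∀
    commute : ∀ a q y → q * (a * y) ⁴ ≡ a ⁴ * q * y ⁴
    commute = solve-∀

  lhs-telescopes : ∀ n → sum< (3 ℕ.+ n) (L Fˡ n) ≡ 0ℤ
  lhs-telescopes n = sum<≡0-by-telescoping (λ _ → Mˡ n) (Gˡ n) (L Fˡ n) (3 ℕ.+ n) (λ _ ()) refl Gˡ-vanishes
    (λ k _ → trans (sym (reassociate (Mˡ n) (L Fˡ n k))) (trans (cong (Mˡ n *_) (Mˡ*LFˡ≡ΔGˡ n k)) (distrib (Mˡ n) (Gˡ n (suc k)) (Gˡ n k))))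
    where
    Gˡ-vanishes : Gˡ n (3 ℕ.+ n) ≡ 0ℤ
    Gˡ-vanishes = trans (cong (λ z → (+ (3 ℕ.+ n)) ⁴ * certificateˡ (+ n) (+ (3 ℕ.+ n)) * (+ z) ⁴) (k>n⇒nCk≡0 (n<1+n (2 ℕ.+ n))))
                        (*-zeroʳ ((+ (3 ℕ.+ n)) ⁴ * certificateˡ (+ n) (+ (3 ℕ.+ n))))
    reassociate : ∀ a t → a * (a * t) ≡ a * a * t
    reassociate = solve-∀
    distrib : ∀ a u v → a * (u - v) ≡ a * u - a * v
    distrib = solve-∀

  lhs-annihilated : Annihilates (λ m → sum< (suc m) (Fˡ m))
  lhs-annihilated = annihilates-column-sums Fˡ (λ m k m<k → cong (λ z → + (z ℕ.^ 4)) (k>n⇒nCk≡0 m<k)) lhs-telescopes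

module BinomialProductSum where

  open import Agda.Builtin.FromNat
  open import Data.Nat as ℕ using (ℕ; zero; suc; _<_; s≤s)
  open import Data.Nat.Properties using (+-suc; +-identityʳ; *-zeroʳ; n∸n≡0; m+n∸m≡n; *-distribˡ-+; n<1+n; m<n⇒m<1+n; m≤n⇒∃[o]m+o≡n; suc-injective)
  open import Data.Nat.Combinatorics using (_C_; k>n⇒nCk≡0; nCn≡1)
  open import Data.Nat.Tactic.RingSolver renaming (solve-∀ to ℕ-solve-∀)
  open import Data.Integer using (ℤ; +_; -[1+_]; 0ℤ; _+_; _*_; _-_)
  open import Data.Integer.Properties as ℤ using (pos-*)
  open import Data.Integer.Tactic.RingSolver using (solve-∀)
  open import Data.Product using (_,_)
  open import Relation.Binary.PropositionalEquality using (_≡_; _≢_; refl; sym; trans; cong; cong₂; subst; module ≡-Reasoning)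
  open Certificates
  open Telescoping
  open BinomialRatios
  open SecondOrder (λ n → c₀ (+ n)) (λ n → c₁ (+ n)) (λ n → c₂ (+ n))

  Fʳ : ℕ → ℕ → ℤ
  Fʳ m k = + ((m C k) ℕ.* ((2 ℕ.* k) C k) ℕ.* ((2 ℕ.* m ℕ.∸ 2 ℕ.* k) C m) ℕ.* ((m ℕ.+ k) C (m ℕ.∸ k)))

  Fʳ′ : ℕ → ℕ → ℤ
  Fʳ′ d k = ((k ℕ.+ d) Cᶻ k) * ((k ℕ.+ k) Cᶻ k) * ((d ℕ.+ d) Cᶻ (k ℕ.+ d)) * ((k ℕ.+ d ℕ.+ k) Cᶻ d)

  Fʳ≡Fʳ′ : ∀ {m} d k → k ℕ.+ d ≡ m → Fʳ m k ≡ Fʳ′ d k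
  Fʳ≡Fʳ′ d k refl = begin
    Fʳ (k ℕ.+ d) k                            ≡⟨ cong₂ (λ a b → shape a b ((k ℕ.+ d) ℕ.∸ k)) (double k) 2[k+d]∸2k≡d+d ⟩
    shape (k ℕ.+ k) (d ℕ.+ d) ((k ℕ.+ d) ℕ.∸ k) ≡⟨ cong (shape (k ℕ.+ k) (d ℕ.+ d)) (m+n∸m≡n k d) ⟩
    shape (k ℕ.+ k) (d ℕ.+ d) d               ≡⟨ pos-*⁴ ((k ℕ.+ d) C k) ((k ℕ.+ k) C k) ((d ℕ.+ d) C (k ℕ.+ d)) ((k ℕ.+ d ℕ.+ k) C d) ⟩
    Fʳ′ d k                                   ∎
    where
    open ≡-Reasoning
    shape : ℕ → ℕ → ℕ → ℤ
    shape a b c = + (((k ℕ.+ d) C k) ℕ.* (a C k) ℕ.* (b C (k ℕ.+ d)) ℕ.* ((k ℕ.+ d ℕ.+ k) C c))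
    double : ∀ m → 2 ℕ.* m ≡ m ℕ.+ m
    double m = cong (m ℕ.+_) (+-identityʳ m)
    2[k+d]∸2k≡d+d : 2 ℕ.* (k ℕ.+ d) ℕ.∸ 2 ℕ.* k ≡ d ℕ.+ d
    2[k+d]∸2k≡d+d = trans (cong (ℕ._∸ 2 ℕ.* k) (*-distribˡ-+ 2 k d)) (trans (m+n∸m≡n (2 ℕ.* k) (2 ℕ.* d)) (double d))
    pos-*⁴ : ∀ a b c d → + (a ℕ.* b ℕ.* c ℕ.* d) ≡ + a * + b * + c * + d
    pos-*⁴ a b c d = trans (pos-* (a ℕ.* b ℕ.* c) d) (cong (_* + d) (trans (pos-* (a ℕ.* b) c) (cong (_* + c) (pos-* a b))))

  Fʳ-support : ∀ m k → m < k → Fʳ m k ≡ 0ℤ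
  Fʳ-support m k m<k =
    cong (λ c → + (c ℕ.* ((2 ℕ.* k) C k) ℕ.* ((2 ℕ.* m ℕ.∸ 2 ℕ.* k) C m) ℕ.* ((m ℕ.+ k) C (m ℕ.∸ k)))) (k>n⇒nCk≡0 m<k)

  Fʳ-diagonal : ∀ m → Fʳ (suc m) (suc m) ≡ 0ℤ
  Fʳ-diagonal m = cong +_ (begin
    x ℕ.* ((2 ℕ.* suc m ℕ.∸ 2 ℕ.* suc m) C suc m) ℕ.* y ≡⟨ cong (λ a → x ℕ.* (a C suc m) ℕ.* y) (n∸n≡0 (2 ℕ.* suc m)) ⟩
    x ℕ.* 0 ℕ.* y                                      ≡⟨ cong (ℕ._* y) (*-zeroʳ x) ⟩
    0                                                  ∎)
    where
    open ≡-Reasoning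
    x = (suc m C suc m) ℕ.* ((2 ℕ.* suc m) C suc m)
    y = (suc m ℕ.+ suc m) C (suc m ℕ.∸ suc m)

  Fʳ-column₀ : ∀ m → Fʳ m 0 ≡ (m ℕ.+ m) Cᶻ m
  Fʳ-column₀ m = cong +_ (trans (cong₂ (λ a b → 1 ℕ.* 1 ℕ.* (a C m) ℕ.* b) (double m) (trans (cong (_C m) (+-identityʳ m)) (nCn≡1 m)))
                                (unit ((m ℕ.+ m) C m)))
    where
    double : ∀ m → 2 ℕ.* m ≡ m ℕ.+ m
    double m = cong (m ℕ.+_) (+-identityʳ m)
    unit : ∀ x → 1 ℕ.* 1 ℕ.* x ℕ.* 1 ≡ x
    unit = ℕ-solve-∀

  central-step : ∀ m → let M = + m in
    Proportional ((1 + M) * (1 + M)) ((suc m ℕ.+ suc m) Cᶻ suc m) ((2 + (M + M)) * (1 + (M + M))) ((m ℕ.+ m) Cᶻ m)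
  central-step m = proportional-coefficients (coefficient (+ m)) refl
    (proportional-chain (proportional-subst (cong (_Cᶻ suc m) (cong suc (sym (+-suc m m)))) refl (Cᶻ-absorb (suc (m ℕ.+ m)) m))
                        (Cᶻ-top-step (m ℕ.+ m) m))
    where
    coefficient : ∀ M → (1 + M) * (1 + (M + M) - M) ≡ (1 + M) * (1 + M)
    coefficient = solve-∀

  -- Each relation multiplies the four binomial ratios of Fʳ′ and cancels a common positive factor.

  Fʳ-relationᴬ : ∀ j e → Proportional (αᴬ (+ j) (+ e)) (Fʳ (j ℕ.+ e) (suc j)) (βᴬ (+ j) (+ e)) (Fʳ (suc (j ℕ.+ e)) j)
  Fʳ-relationᴬ j zero    = proportional (trans (cong (αᴬ (+ j) 0 *_) (Fʳ-support (j ℕ.+ 0) (suc j) j+0<1+j)) (ℤ.*-zeroʳ (αᴬ (+ j) 0)))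
    where
    j+0<1+j : j ℕ.+ 0 < suc j
    j+0<1+j = subst (_< suc j) (sym (+-identityʳ j)) (n<1+n j)
  Fʳ-relationᴬ j (suc e) =
    proportional-subst (sym (Fʳ≡Fʳ′ e (suc j) (sym (+-suc j e)))) (sym (Fʳ≡Fʳ′ (suc (suc e)) j (+-suc j (suc e))))
      (proportional-rescale (2 * (1 + J) * (1 + (J + J)) * (1 + E) * (2 + E) * (2 + (J + E))) (λ ()) (normα J E) (normβ J E)
        (proportional-product stepᴬ (central-step j) stepᶜ stepᴰ))
    where
    J E : ℤ
    J = + j
    E = + e
    stepᴬ : Proportional ((1 + J) * (1 + (J + (1 + E)))) (suc (j ℕ.+ e) Cᶻ suc j)
                         ((J + (1 + E) - J) * (1 + (J + (1 + E)) - J)) ((j ℕ.+ suc (suc e)) Cᶻ j)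
    stepᴬ = proportional-subst (cong (_Cᶻ suc j) (+-suc j e)) (cong (_Cᶻ j) (sym (+-suc j (suc e))))
      (proportional-chain (Cᶻ-bottom-step (j ℕ.+ suc e) j) (proportional-sym (Cᶻ-top-step (j ℕ.+ suc e) j)))
    stepᶜ : Proportional ((1 + (E + E)) * (2 + (E + E)) * (3 + (E + E)) * (4 + (E + E))) ((e ℕ.+ e) Cᶻ suc (j ℕ.+ e))
                         ((1 + (E + E) - (1 + (J + E))) * (2 + (E + E) - (1 + (J + E))) * (3 + (E + E) - (1 + (J + E))) * (2 + (J + E)))
                         ((suc (suc e) ℕ.+ suc (suc e)) Cᶻ (j ℕ.+ suc (suc e)))
    stepᶜ = proportional-subst refl (cong₂ _Cᶻ_ (sym (top e)) (sym (bottom j e)))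
      (proportional-chain (proportional-chain (proportional-chain
        (proportional-sym (Cᶻ-top-step (e ℕ.+ e) (suc (j ℕ.+ e))))
        (proportional-sym (Cᶻ-top-step (1 ℕ.+ (e ℕ.+ e)) (suc (j ℕ.+ e)))))
        (proportional-sym (Cᶻ-top-step (2 ℕ.+ (e ℕ.+ e)) (suc (j ℕ.+ e)))))
        (proportional-sym (Cᶻ-absorb (3 ℕ.+ (e ℕ.+ e)) (suc (j ℕ.+ e)))))
      where
      top : ∀ e → suc (suc e) ℕ.+ suc (suc e) ≡ 4 ℕ.+ (e ℕ.+ e)
      top = ℕ-solve-∀
      bottom : ∀ j e → j ℕ.+ suc (suc e) ≡ 2 ℕ.+ (j ℕ.+ e)
      bottom = ℕ-solve-∀
    stepᴰ : Proportional ((2 + (J + E + J) - E) * (2 + (J + E + J) - (1 + E))) ((suc j ℕ.+ e ℕ.+ suc j) Cᶻ e)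
                         ((1 + E) * (2 + E)) ((j ℕ.+ suc (suc e) ℕ.+ j) Cᶻ suc (suc e))
    stepᴰ = proportional-subst (cong (_Cᶻ e) (sym (topˡ j e))) (cong (_Cᶻ suc (suc e)) (sym (topʳ j e)))
      (proportional-chain (proportional-sym (Cᶻ-bottom-step (2 ℕ.+ (j ℕ.+ e ℕ.+ j)) e))
                          (proportional-sym (Cᶻ-bottom-step (2 ℕ.+ (j ℕ.+ e ℕ.+ j)) (suc e))))
      where
      topˡ : ∀ j e → suc j ℕ.+ e ℕ.+ suc j ≡ 2 ℕ.+ (j ℕ.+ e ℕ.+ j)
      topˡ = ℕ-solve-∀
      topʳ : ∀ j e → j ℕ.+ suc (suc e) ℕ.+ j ≡ 2 ℕ.+ (j ℕ.+ e ℕ.+ j)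
      topʳ = ℕ-solve-∀
    normα : ∀ J E → 2 * (1 + J) * (1 + (J + J)) * (1 + E) * (2 + E) * (2 + (J + E)) * αᴬ J (1 + E)
      ≡ (1 + J) * (1 + (J + (1 + E))) * ((1 + J) * (1 + J)) * ((1 + (E + E)) * (2 + (E + E)) * (3 + (E + E)) * (4 + (E + E)))
        * ((2 + (J + E + J) - E) * (2 + (J + E + J) - (1 + E)))
    normα = solve-∀
    normβ : ∀ J E → 2 * (1 + J) * (1 + (J + J)) * (1 + E) * (2 + E) * (2 + (J + E)) * βᴬ J (1 + E)
      ≡ (J + (1 + E) - J) * (1 + (J + (1 + E)) - J) * ((2 + (J + J)) * (1 + (J + J)))
        * ((1 + (E + E) - (1 + (J + E))) * (2 + (E + E) - (1 + (J + E))) * (3 + (E + E) - (1 + (J + E))) * (2 + (J + E)))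
        * ((1 + E) * (2 + E))
    normβ = solve-∀

  Fʳ-relationᴮ : ∀ j e → Proportional (αᴮ (+ j) (+ e)) (Fʳ (suc (j ℕ.+ e)) (suc j)) (βᴮ (+ j) (+ e)) (Fʳ (suc (j ℕ.+ e)) j)
  Fʳ-relationᴮ j e =
    proportional-subst (sym (Fʳ≡Fʳ′ e (suc j) refl)) (sym (Fʳ≡Fʳ′ (suc e) j (+-suc j e)))
      (proportional-rescale (2 * (1 + J) * (1 + (J + J)) * (1 + E)) (λ ()) (normα J E) (normβ J E)
        (proportional-product stepᴬ (central-step j) stepᶜ stepᴰ))
    where
    J E : ℤ
    J = + j
    E = + e
    stepᴬ : Proportional (1 + J) (suc (j ℕ.+ e) Cᶻ suc j) (1 + (J + E) - J) ((j ℕ.+ suc e) Cᶻ j)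
    stepᴬ = proportional-subst refl (cong (_Cᶻ j) (sym (+-suc j e))) (Cᶻ-bottom-step (suc (j ℕ.+ e)) j)
    stepᶜ : Proportional ((1 + (E + E)) * (2 + (E + E))) ((e ℕ.+ e) Cᶻ suc (j ℕ.+ e))
                         ((1 + (E + E) - (1 + (J + E))) * (2 + (E + E) - (1 + (J + E)))) ((suc e ℕ.+ suc e) Cᶻ (j ℕ.+ suc e))
    stepᶜ = proportional-subst refl (cong₂ _Cᶻ_ (cong suc (sym (+-suc e e))) (sym (+-suc j e)))
      (proportional-chain (proportional-sym (Cᶻ-top-step (e ℕ.+ e) (suc (j ℕ.+ e))))
                          (proportional-sym (Cᶻ-top-step (suc (e ℕ.+ e)) (suc (j ℕ.+ e)))))
    stepᴰ : Proportional ((2 + (J + E + J) - E) * (1 + (J + E + J) - E)) ((suc j ℕ.+ e ℕ.+ suc j) Cᶻ e)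
                         ((2 + (J + E + J)) * (1 + E)) ((j ℕ.+ suc e ℕ.+ j) Cᶻ suc e)
    stepᴰ = proportional-subst (cong (λ a → suc a Cᶻ e) (sym (+-suc (j ℕ.+ e) j))) (cong (λ a → (a ℕ.+ j) Cᶻ suc e) (sym (+-suc j e)))
      (proportional-chain (Cᶻ-top-step (suc (j ℕ.+ e ℕ.+ j)) e) (proportional-sym (Cᶻ-bottom-step (suc (j ℕ.+ e ℕ.+ j)) e)))
    normα : ∀ J E → 2 * (1 + J) * (1 + (J + J)) * (1 + E) * αᴮ J E
      ≡ (1 + J) * ((1 + J) * (1 + J)) * ((1 + (E + E)) * (2 + (E + E))) * ((2 + (J + E + J) - E) * (1 + (J + E + J) - E))
    normα = solve-∀
    normβ : ∀ J E → 2 * (1 + J) * (1 + (J + J)) * (1 + E) * βᴮ J E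
      ≡ (1 + (J + E) - J) * ((2 + (J + J)) * (1 + (J + J))) * ((1 + (E + E) - (1 + (J + E))) * (2 + (E + E) - (1 + (J + E))))
        * ((2 + (J + E + J)) * (1 + E))
    normβ = solve-∀

  Fʳ-relationᶜ : ∀ j e → Proportional (αᶜ (+ j) (+ e)) (Fʳ (suc (suc (j ℕ.+ e))) (suc j)) (βᶜ (+ j) (+ e)) (Fʳ (suc (j ℕ.+ e)) j)
  Fʳ-relationᶜ j e =
    proportional-subst (sym (Fʳ≡Fʳ′ (suc e) (suc j) (cong suc (+-suc j e)))) (sym (Fʳ≡Fʳ′ (suc e) j (+-suc j e)))
      (proportional-rescale (2 * (1 + J) * (1 + (J + J)) * (2 + (J + E))) (λ ()) (normα J E) (normβ J E)
        (proportional-product (Cᶻ-absorb (j ℕ.+ suc e) j) (central-step j) (Cᶻ-bottom-step (suc e ℕ.+ suc e) (j ℕ.+ suc e)) stepᴰ))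
    where
    J E : ℤ
    J = + j
    E = + e
    stepᴰ : Proportional ((3 + (J + E + J) - (1 + E)) * (2 + (J + E + J) - (1 + E))) ((suc j ℕ.+ suc e ℕ.+ suc j) Cᶻ suc e)
                         ((3 + (J + E + J)) * (2 + (J + E + J))) ((j ℕ.+ suc e ℕ.+ j) Cᶻ suc e)
    stepᴰ = proportional-subst (cong (_Cᶻ suc e) (sym (topˡ j e))) (cong (λ a → (a ℕ.+ j) Cᶻ suc e) (sym (+-suc j e)))
      (proportional-chain (Cᶻ-top-step (suc (suc (j ℕ.+ e ℕ.+ j))) (suc e)) (Cᶻ-top-step (suc (j ℕ.+ e ℕ.+ j)) (suc e)))
      where
      topˡ : ∀ j e → suc j ℕ.+ suc e ℕ.+ suc j ≡ 3 ℕ.+ (j ℕ.+ e ℕ.+ j)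
      topˡ = ℕ-solve-∀
    normα : ∀ J E → 2 * (1 + J) * (1 + (J + J)) * (2 + (J + E)) * αᶜ J E
      ≡ (1 + J) * ((1 + J) * (1 + J)) * (1 + (J + (1 + E))) * ((3 + (J + E + J) - (1 + E)) * (2 + (J + E + J) - (1 + E)))
    normα = solve-∀
    normβ : ∀ J E → 2 * (1 + J) * (1 + (J + J)) * (2 + (J + E)) * βᶜ J E
      ≡ (1 + (J + (1 + E))) * ((2 + (J + J)) * (1 + (J + J))) * ((1 + E) + (1 + E) - (J + (1 + E)))
        * ((3 + (J + E + J)) * (2 + (J + E + J)))
    normβ = solve-∀

  dʳₙ : ℕ → ℕ → ℤ
  dʳₙ n k = dʳ (+ n) (+ k)

  dʳₙ≢0 : ∀ n k → dʳₙ n k ≢ 0ℤ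
  dʳₙ≢0 n k eq = odd≢0 (+ n + 1 - + k) (trans (sym (odd (+ n) (+ k))) eq)
    where
    odd : ∀ N K → dʳ N K ≡ 1 + ((N + 1 - K) + (N + 1 - K))
    odd = solve-∀
    odd≢0 : ∀ x → 1 + (x + x) ≢ 0ℤ
    odd≢0 (+ m)    ()
    odd≢0 -[1+ m ] ()

  Hʳ : ℕ → ℕ → ℤ
  Hʳ n zero    = 0ℤ
  Hʳ n (suc j) = certificateʳ (+ n) (+ suc j) * Fʳ (suc n) j

  RhsStep : ℕ → ℕ → Set
  RhsStep n = TelescopingStep (dʳₙ n) (Hʳ n) (L Fʳ n)

  rhs-step-initial : ∀ n → RhsStep n 0
  rhs-step-initial n = ≡-by-certificate (((1 + N) * (2 + N)) * ((1 + N) * (2 + N))) (λ ())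
    (certificateʳ-initial-identity N (Fʳ n 0) (Fʳ (suc n) 0) (Fʳ (suc (suc n)) 0))
    (combination₂≡0 (μ₁ N) (μ₂ N) (cross-difference (column-step n)) (cross-difference (column-step (suc n))))
    where
    N = + n
    column-step : ∀ m → Proportional ((1 + + m) * (1 + + m)) (Fʳ (suc m) 0) ((2 + (+ m + + m)) * (1 + (+ m + + m))) (Fʳ m 0)
    column-step m = proportional-subst (sym (Fʳ-column₀ (suc m))) (sym (Fʳ-column₀ m)) (central-step m)

  rhs-step-interior : ∀ j e → RhsStep (j ℕ.+ e) (suc j)
  rhs-step-interior j e = ≡-by-certificate (4 * (1 + + j) ³) (λ ())
    (certificateʳ-identity (+ j) (+ e) (Fʳ (j ℕ.+ e) (suc j)) (Fʳ (suc (j ℕ.+ e)) (suc j)) (Fʳ (suc (suc (j ℕ.+ e))) (suc j))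
                           (Fʳ (suc (j ℕ.+ e)) j))
    (combination₃≡0 (λᴬ (+ j) (+ e)) (λᴮ (+ j) (+ e)) (λᶜ (+ j) (+ e))
      (cross-difference (Fʳ-relationᴬ j e)) (cross-difference (Fʳ-relationᴮ j e)) (cross-difference (Fʳ-relationᶜ j e)))

  Hʳ-vanishes : ∀ n → Hʳ n (3 ℕ.+ n) ≡ 0ℤ
  Hʳ-vanishes n = trans (cong (certificateʳ (+ n) (+ (3 ℕ.+ n)) *_) (Fʳ-support (suc n) (suc (suc n)) (n<1+n (suc n))))
                        (ℤ.*-zeroʳ (certificateʳ (+ n) (+ (3 ℕ.+ n))))

  rhs-step-final : ∀ n → RhsStep n (suc (suc n))
  rhs-step-final n = begin
    dʳₙ n (3 ℕ.+ n) * dʳₙ n (2 ℕ.+ n) * L Fʳ n (2 ℕ.+ n)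
      ≡⟨ cong (dʳₙ n (3 ℕ.+ n) * dʳₙ n (2 ℕ.+ n) *_) L≡0 ⟩
    dʳₙ n (3 ℕ.+ n) * dʳₙ n (2 ℕ.+ n) * 0ℤ
      ≡⟨ zeros (dʳₙ n (3 ℕ.+ n)) (dʳₙ n (2 ℕ.+ n)) ⟩
    dʳₙ n (2 ℕ.+ n) * 0ℤ - dʳₙ n (3 ℕ.+ n) * 0ℤ
      ≡⟨ cong₂ (λ u v → dʳₙ n (2 ℕ.+ n) * u - dʳₙ n (3 ℕ.+ n) * v) (sym (Hʳ-vanishes n)) (sym H₂₊ₙ≡0) ⟩
    dʳₙ n (2 ℕ.+ n) * Hʳ n (3 ℕ.+ n) - dʳₙ n (3 ℕ.+ n) * Hʳ n (2 ℕ.+ n) ∎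
    where
    open ≡-Reasoning
    L≡0 : L Fʳ n (2 ℕ.+ n) ≡ 0ℤ
    L≡0 = combination₃≡0 (c₀ (+ n)) (c₁ (+ n)) (c₂ (+ n))
      (Fʳ-support n (2 ℕ.+ n) (m<n⇒m<1+n (n<1+n n))) (Fʳ-support (suc n) (2 ℕ.+ n) (n<1+n (suc n))) (Fʳ-diagonal (suc n))
    H₂₊ₙ≡0 : Hʳ n (2 ℕ.+ n) ≡ 0ℤ
    H₂₊ₙ≡0 = trans (cong (certificateʳ (+ n) (+ (2 ℕ.+ n)) *_) (Fʳ-diagonal n)) (ℤ.*-zeroʳ (certificateʳ (+ n) (+ (2 ℕ.+ n))))
    zeros : ∀ a b → a * b * 0ℤ ≡ b * 0ℤ - a * 0ℤ
    zeros = solve-∀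

  rhs-step : ∀ n k → k < 3 ℕ.+ n → RhsStep n k
  rhs-step n zero    _ = rhs-step-initial n
  rhs-step n (suc j) (s≤s (s≤s j≤1+n)) with m≤n⇒∃[o]m+o≡n j≤1+n
  ... | zero  , j+0≡1+n   = subst (λ i → RhsStep n (suc i)) (sym (trans (sym (+-identityʳ j)) j+0≡1+n)) (rhs-step-final n)
  ... | suc e , j+1+e≡1+n = subst (λ m → RhsStep m (suc j)) (suc-injective (trans (sym (+-suc j e)) j+1+e≡1+n)) (rhs-step-interior j e)

  rhs-telescopes : ∀ n → sum< (3 ℕ.+ n) (L Fʳ n) ≡ 0ℤ
  rhs-telescopes n = sum<≡0-by-telescoping (dʳₙ n) (Hʳ n) (L Fʳ n) (3 ℕ.+ n) (dʳₙ≢0 n) refl (Hʳ-vanishes n) (rhs-step n)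

  rhs-annihilated : Annihilates (λ m → sum< (suc m) (Fʳ m))
  rhs-annihilated = annihilates-column-sums Fʳ Fʳ-support rhs-telescopes

open import Defs
open import Data.Nat using (ℕ; _+_; _*_; _∸_; _^_)
open import Data.Nat.Combinatorics using (_C_)
open import Relation.Binary.PropositionalEquality using (_≡_)
open import Data.Nat using (suc)
open import Data.Integer using (+_)
open import Data.Integer.Properties using (+-injective)
open import Relation.Binary.PropositionalEquality using (cong; sym; refl; module ≡-Reasoning)
open Certificates using (c₀; c₁; c₂)
open Telescoping using (sum<; sumTo≡sum<; module SecondOrder)
open SecondOrder (λ n → c₀ (+ n)) (λ n → c₁ (+ n)) (λ n → c₂ (+ n)) using (annihilated-sequences-agree)
open FourthPowerSum using (Fˡ; lhs-annihilated)
open BinomialProductSum using (Fʳ; rhs-annihilated)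

mainTheorem11 : (n : ℕ) →
    ((2 * n) C n) * sumTo n (λ k → (n C k) ^ 4)
      ≡ ((2 * n) C n) * sumTo n (λ k → (n C k) * ((2 * k) C k) * ((2 * n ∸ 2 * k) C n) * ((n + k) C (n ∸ k)))
mainTheorem11 n = cong (((2 * n) C n) *_) (+-injective (begin
  + sumTo n (λ k → (n C k) ^ 4)
    ≡⟨ sumTo≡sum< n _ ⟩
  sum< (suc n) (Fˡ n)
    ≡⟨ annihilated-sequences-agree (λ _ ()) {λ m → sum< (suc m) (Fˡ m)} {λ m → sum< (suc m) (Fʳ m)}
                                   lhs-annihilated rhs-annihilated refl refl n ⟩
  sum< (suc n) (Fʳ n)
    ≡⟨ sym (sumTo≡sum< n _) ⟩
  + sumTo n (λ k → (n C k) * ((2 * k) C k) * ((2 * n ∸ 2 * k) C n) * ((n + k) C (n ∸ k))) ∎))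
  where open ≡-Reasoning
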